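{- Let $\approx$ be an SCER on $\Sigma^*$ and $T$ a string. For any $C,C'\in\mathsf{Cov}_{\approx}(T)$ with $|C|\le|C'|$, we have $C\in\mathsf{Cov}_{\approx}(C')$.
   Context: $\Sigma^*$ is the set of strings over an alphabet $\Sigma$. For a string $T$, $|T|$ is its length, $T[i:j]$ the substring from position $i$ to $j$, $T[:j]=T[1:j]$, $T[i:]=T[i:|T|]$. An SCER is an equivalence relation $\approx$ on $\Sigma^*$ such that $X\approx Y$ implies $|X|=|Y|$ and $X[i:j]\approx Y[i:j]$ for all $1\le i\le j\le|X|$. $\mathsf{Occ}_{P,T}=\{\,i : 1\le i\le |T|-|P|+1,\ P\approx T[i:i+|P|-1]\,\}$. A string $C$ of length $c$ is a $\approx$-cover of $T$ of length $n$ if there are $x_1,\dots,x_m\in\mathsf{Occ}_{C,T}$ with $x_1=1$, $x_m=n-c+1$ and $x_{i-1}<x_i\le x_{i-1}+c$ for all $1<i\le m$; $\mathsf{Cov}_\approx(T)$ is the set of all $\approx$-covers of $T$. -}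

module Defs where

open import Level using (Level; _⊔_)
open import Data.Nat using (ℕ; zero; suc; _+_; _∸_; _≤_; _<_)
open import Data.List using (List; []; _∷_; length; take; drop)
open import Data.Product using (Σ; _×_; _,_)
open import Relation.Binary.Core using (Rel)
open import Relation.Binary.Structures using (IsEquivalence)
open import Relation.Binary.PropositionalEquality using (_≡_)

-- Strings over an alphabet A are lists; positions are 1-based.
-- Substring T[i:j] (1 ≤ i ≤ j ≤ |T|) = characters at positions i..j.
substr : ∀ {a} {A : Set a} → List A → ℕ → ℕ → List A
substr T i j = take (suc j ∸ i) (drop (i ∸ 1) T)

record SCER {a} (A : Set a) ℓ : Set (a ⊔ Level.suc ℓ) where
  field
    _≈_          : Rel (List A) ℓ
    isEquivalence : IsEquivalence _≈_
    length-≈     : ∀ {X Y} → X ≈ Y → length X ≡ length Y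
    substr-≈     : ∀ {X Y} → X ≈ Y → ∀ i j → 1 ≤ i → i ≤ j → j ≤ length X →
                   substr X i j ≈ substr Y i j

module _ {a ℓ} {A : Set a} (R : SCER A ℓ) where
  open SCER R

  InOcc : List A → List A → ℕ → Set ℓ
  InOcc P T i = (1 ≤ i) × (i + length P ≤ suc (length T)) ×
                (P ≈ substr T i (i + length P ∸ 1))

  data Chain (C T : List A) : ℕ → ℕ → Set (a ⊔ ℓ) where
    single : ∀ {x} → InOcc C T x → Chain C T x x
    step   : ∀ {x x' y} → InOcc C T x → x < x' → x' ≤ x + length C →
             Chain C T x' y → Chain C T x y

  IsCover : List A → List A → Set (a ⊔ ℓ)
  IsCover C T = Chain C T 1 (suc (length T) ∸ length C)

-- Both covers occur at the two ends of T: C' ≈ T[1 : c'] and C' ≈ T[n-c'+1 : n].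
-- Every occurrence of C in T starting at x ≤ c'-c+1 lies inside the prefix
-- copy of C', hence is an occurrence of C in C'; and the last occurrence of C
-- in T, at n-c+1, lies inside the suffix copy of C' at offset c'-c, giving an
-- occurrence of C in C' at c'-c+1. Cutting the chain of C-occurrences in T at
-- c'-c+1 therefore yields a chain covering C'.
module Submission where

open import Defs
open import Data.Nat using (ℕ; zero; suc; _+_; _∸_; _≤_; z≤n; s≤s; _≤?_; s≤s⁻¹)
open import Data.Nat.Properties
open import Data.List using (List; length; take; drop)
open import Data.List.Properties using (take-take; take-drop; drop-drop)
open import Data.Product using (_,_)
open import Data.Sum using (inj₁; inj₂)
open import Relation.Nullary using (yes; no)
open import Relation.Binary.Structures using (IsEquivalence)
open import Relation.Binary.PropositionalEquality
  using (_≡_; refl; cong; subst; subst₂; sym; trans; module ≡-Reasoning)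

window : ∀ {a} {A : Set a} → ℕ → ℕ → List A → List A
window k c X = take c (drop k X)

substr≡window : ∀ {a} {A : Set a} (X : List A) k c → substr X (suc k) (k + c) ≡ window k c X
substr≡window X k c = cong (λ l → take l (drop k X)) (m+n∸m≡n k c)

take-take-≤ : ∀ {a} {A : Set a} {l m} (xs : List A) → l ≤ m → take l (take m xs) ≡ take l xs
take-take-≤ {l = l} {m} xs l≤m = trans (take-take l m xs) (cong (λ i → take i xs) (m≤n⇒m⊓n≡m l≤m))

window-take : ∀ {a} {A : Set a} k c {m} (xs : List A) → k + c ≤ m →
              window k c (take m xs) ≡ window k c xs
window-take k c {m} xs k+c≤m = begin
  take c (drop k (take m xs))          ≡⟨ take-drop c k (take m xs) ⟩
  drop k (take (k + c) (take m xs))    ≡⟨ cong (drop k) (take-take-≤ xs k+c≤m) ⟩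
  drop k (take (k + c) xs)             ≡⟨ sym (take-drop c k xs) ⟩
  take c (drop k xs)                   ∎
  where open ≡-Reasoning

window-window : ∀ {a} {A : Set a} p k c {c'} (xs : List A) → k + c ≤ c' →
                window k c (window p c' xs) ≡ window (p + k) c xs
window-window p k c xs k+c≤c' =
  trans (window-take k c (drop p xs) k+c≤c') (cong (take c) (drop-drop p k xs))

module _ {a ℓ} {A : Set a} (R : SCER A ℓ) where
  open SCER R
  open IsEquivalence isEquivalence renaming (sym to ≈-sym; trans to ≈-trans)

  window-≈ : ∀ {X Y} → X ≈ Y → ∀ k c → k + c ≤ length X → window k c X ≈ window k c Y
  window-≈ X≈Y k zero _ = IsEquivalence.refl isEquivalence
  window-≈ {X} {Y} X≈Y k (suc c) bound =
    subst₂ _≈_ (substr≡window X k (suc c)) (substr≡window Y k (suc c))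
      (substr-≈ X≈Y (suc k) (k + suc c) (s≤s z≤n) (≤-trans (s≤s (m≤m+n k c)) (≤-reflexive (sym (+-suc k c)))) bound)

  occ⇒≈window : ∀ {P T k} → InOcc R P T (suc k) → P ≈ window k (length P) T
  occ⇒≈window {P} {T} {k} (_ , _ , P≈) = subst (P ≈_) (substr≡window T k (length P)) P≈

  ≈window⇒occ : ∀ {P T k} → k + length P ≤ length T → P ≈ window k (length P) T →
                InOcc R P T (suc k)
  ≈window⇒occ {P} {T} {k} bound P≈ =
    s≤s z≤n , s≤s bound , subst (P ≈_) (sym (substr≡window T k (length P))) P≈

  occ-length : ∀ {P T x} → InOcc R P T x → length P ≤ length T
  occ-length {P} {x = suc x} (_ , bound , _) = ≤-trans (m≤n+m (length P) x) (s≤s⁻¹ bound)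

  occ-within : ∀ {C C' T p k} → InOcc R C' T (suc p) → InOcc R C T (suc (p + k)) →
               k + length C ≤ length C' → InOcc R C C' (suc k)
  occ-within {C} {C'} {T} {p} {k} occ' occ bound = ≈window⇒occ bound
    (≈-trans (occ⇒≈window occ)
      (≈-sym (subst (window k (length C) C' ≈_)
                    (window-window p k (length C) T bound)
                    (window-≈ (occ⇒≈window occ') k (length C) bound))))

  chain-head : ∀ {C T x y} → Chain R C T x y → InOcc R C T x
  chain-head (single o) = o
  chain-head (step o _ _ _) = o

  chain-last : ∀ {C T x y} → Chain R C T x y → InOcc R C T y
  chain-last (single o) = o
  chain-last (step _ _ _ rest) = chain-last rest

  module _ {C T U : List A} {L : ℕ}
           (transfer : ∀ {z} → InOcc R C T z → z ≤ L → InOcc R C U z)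
           (occ-L : InOcc R C U L) where

    chain-truncate : ∀ {x y} → Chain R C T x y → x ≤ L → L ≤ y → Chain R C U x L
    chain-truncate {x} (single o) x≤L L≤y =
      subst (Chain R C U x) (≤-antisym x≤L L≤y) (single (transfer o x≤L))
    chain-truncate {x} (step {x' = x'} o x<x' x'≤ rest) x≤L L≤y with x' ≤? L
    ... | yes x'≤L = step (transfer o x≤L) x<x' x'≤ (chain-truncate rest x'≤L L≤y)
    ... | no x'≰L with m≤n⇒m<n∨m≡n x≤L
    ...   | inj₁ x<L = step (transfer o x≤L) x<L (≤-trans (<⇒≤ (≰⇒> x'≰L)) x'≤) (single occ-L)
    ...   | inj₂ refl = single occ-L

lemma4 : ∀ {a ℓ} {A : Set a} (R : SCER A ℓ) (T C C' : List A) →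
    IsCover R C T → IsCover R C' T → length C ≤ length C' →
    IsCover R C C'
lemma4 R T C C' covC covC' c≤c' =
  subst (Chain R C C' 1) (sym (+-∸-assoc 1 c≤c'))
    (chain-truncate R transfer occ-end covC (s≤s z≤n)
      (subst (_≤ suc n ∸ c) (+-∸-assoc 1 c≤c') (∸-monoˡ-≤ c (s≤s c'≤n))))
  where
  n = length T
  c = length C
  c' = length C'
  c'≤n = occ-length R (chain-head R covC')
  transfer : ∀ {z} → InOcc R C T z → z ≤ suc (c' ∸ c) → InOcc R C C' z
  transfer {suc k} occ (s≤s k≤d) = occ-within R (chain-head R covC') occ (m≤o∸n⇒m+n≤o k c≤c' k≤d)
  -- The suffix copy of C' in T starts at offset n ∸ c'.
  last-offset : suc n ∸ c ≡ suc (n ∸ c' + (c' ∸ c))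
  last-offset = begin
    suc n ∸ c                  ≡⟨ +-∸-assoc 1 (≤-trans c≤c' c'≤n) ⟩
    suc (n ∸ c)                ≡⟨ cong (λ m → suc (m ∸ c)) (sym (m∸n+n≡m c'≤n)) ⟩
    suc (n ∸ c' + c' ∸ c)      ≡⟨ cong suc (+-∸-assoc (n ∸ c') c≤c') ⟩
    suc (n ∸ c' + (c' ∸ c))    ∎
    where open ≡-Reasoning
  occ-end : InOcc R C C' (suc (c' ∸ c))
  occ-end = occ-within R (subst (InOcc R C' T) (+-∸-assoc 1 c'≤n) (chain-last R covC'))
                         (subst (InOcc R C T) last-offset (chain-last R covC))
                         (≤-reflexive (m∸n+n≡m c≤c'))
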